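{- Let $\ell$ be an odd prime and $q\in\mathbb Z_\ell$ with $q\equiv1\pmod\ell$, $q\ne1$. For $n\ge0$ let $k_n$ be the least positive integer with $q^{k_n}\equiv1\pmod{\ell^n}$, and let $\rho$ be a positive integer multiple of $k_n$. Then for every $w\in\mathbb Z_\ell$, $$S_{\rho,n}(w):=\sum_{i=1}^{\rho}\zeta_{\ell^n}^{q^iw}\equiv0\pmod{\rho}$$ in $\mathbb Z_\ell[\zeta_{\ell^n}]$.
   Context: $\zeta_{\ell^n}$ denotes a fixed primitive $\ell^n$-th root of unity in $\overline{\mathbb Q}_\ell$, and $\zeta_{\ell^n}^{x}$ for $x\in\mathbb Z_\ell$ is defined via $x$ mod $\ell^n$. -}

module Defs where

open import Data.Nat as ℕ using (ℕ; zero; suc; NonZero; _∸_)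
open import Data.Nat.Properties using (m^n≢0; _<?_; _≟_)
open import Data.Integer as ℤ using (ℤ; +_; -_; _-_; _*_; _+_; 0ℤ; 1ℤ)
open import Data.Integer.Divisibility using (_∣_)
open import Data.Fin using (Fin; toℕ)
open import Data.Bool using (if_then_else_; _∧_)
open import Data.Product using (Σ; _×_)
open import Data.Nat.Divisibility using (divides)
open import Relation.Binary.PropositionalEquality using (refl)
open import Relation.Nullary.Decidable using (does)

-- ℓ-adic integers ℤ_ℓ, as the inverse limit of ℤ/ℓ^m :
-- a coherent sequence of integer approximations x_m with
-- x_{m+1} ≡ x_m (mod ℓ^m); then x ≡ x_m (mod ℓ^m) in ℤ_ℓ.

record ℤ-adic (ℓ : ℕ) : Set where
  field
    approx : ℕ → ℤ
    compat : ∀ m → (+ (ℓ ℕ.^ m)) ∣ (approx (suc m) - approx m)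
open ℤ-adic public

_≈ₐ_ : {ℓ : ℕ} → ℤ-adic ℓ → ℤ-adic ℓ → Set
_≈ₐ_ {ℓ} x y = ∀ m → (+ (ℓ ℕ.^ m)) ∣ (approx x m - approx y m)

oneₐ : (ℓ : ℕ) → ℤ-adic ℓ
oneₐ ℓ = record { approx = λ _ → 1ℤ ; compat = λ m → divides 0 refl }

PowCong1 : {ℓ : ℕ} → ℤ-adic ℓ → ℕ → ℕ → Set
PowCong1 {ℓ} q k n = (+ (ℓ ℕ.^ n)) ∣ ((approx q n ℤ.^ k) - 1ℤ)

IsLeastOrder : {ℓ : ℕ} → ℤ-adic ℓ → ℕ → ℕ → Set
IsLeastOrder q n k =
  (0 ℕ.< k) × PowCong1 q k n × (∀ j → 0 ℕ.< j → PowCong1 q j n → k ℕ.≤ j)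

-- The ring ℤ[ζ_{ℓ^n}] (ℓ prime) ≅ ℤ[x]/Φ_{ℓ^n}(x), elements written in the
-- power basis 1, ζ, …, ζ^{φ(ℓ^n)-1}; ℤ_ℓ[ζ_{ℓ^n}] likewise with ℤ_ℓ-coefficients.

module Cyclotomic (ℓ : ℕ) .{{_ : NonZero ℓ}} where

  φ : ℕ → ℕ
  φ zero    = 1
  φ (suc m) = (ℓ ∸ 1) ℕ.* (ℓ ℕ.^ m)

  ℤζ : ℕ → Set
  ℤζ n = Fin (φ n) → ℤ

  ℤₗζ : ℕ → Set
  ℤₗζ n = Fin (φ n) → ℤ-adic ℓ

  -- coordinates of ζ_{ℓ^n}^j for 0 ≤ j < ℓ^n, reduced with
  -- ζ^{(ℓ-1)ℓ^{n-1}} = - Σ_{k=0}^{ℓ-2} ζ^{k ℓ^{n-1}}  (Φ_{ℓ^n}(ζ) = 0)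
  ζpow : (n j : ℕ) → ℤζ n
  ζpow n j e =
    if does (j <? φ n)
    then (if does (toℕ e ≟ j) then 1ℤ else 0ℤ)
    else (if does (ℕ._%_ (toℕ e) (ℓ ℕ.^ (n ∸ 1)) {{m^n≢0 ℓ (n ∸ 1)}} ≟ (j ∸ φ n))
          then - 1ℤ else 0ℤ)

  -- ζ_{ℓ^n}^x for x ∈ ℤ_ℓ, via x mod ℓ^n (= x_n mod ℓ^n)
  ζ^ₐ : (n : ℕ) → ℤ → ℤζ n
  ζ^ₐ n x = ζpow n (ℤ._%ℕ_ x (ℓ ℕ.^ n) {{m^n≢0 ℓ n}})

  Σ₁ : (n : ℕ) → ℕ → (ℕ → ℤζ n) → ℤζ n
  Σ₁ n zero    f e = 0ℤ
  Σ₁ n (suc r) f e = Σ₁ n r f e + f (suc r) e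

  -- S_{ρ,n}(w) = Σ_{i=1}^{ρ} ζ_{ℓ^n}^{q^i w}; the exponent q^i w ∈ ℤ_ℓ is
  -- only needed mod ℓ^n, where it is q_n^i * w_n.
  S : (q w : ℤ-adic ℓ) (ρ n : ℕ) → ℤζ n
  S q w ρ n = Σ₁ n ρ (λ i → ζ^ₐ n ((approx q n ℤ.^ i) * approx w n))

  -- v ≡ 0 (mod ρ) in ℤ_ℓ[ζ_{ℓ^n}] : v = ρ·t for some t ∈ ℤ_ℓ[ζ_{ℓ^n}]
  -- (ρ·t = v coordinatewise, equality in ℤ_ℓ)
  DivisibleInℤₗζ : (n : ℕ) → ℕ → ℤζ n → Set
  DivisibleInℤₗζ n ρ v =
    Σ (ℤₗζ n) λ t → ∀ e m → (+ (ℓ ℕ.^ m)) ∣ ((+ ρ) * approx (t e) m - v e)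

module Submission where

-- Write N = ℓⁿ, Q = q mod N, W = w mod N. The terms ζ^(Qⁱ W) of S depend on i only modulo k, hence
-- modulo ρ. If QW ≡ W (mod N), every term is ζ^W and S = ρ ζ^W. Otherwise n ≥ 1, and lifting the
-- exponent (ℓ odd, Q ≡ 1 mod ℓ) gives s with W (Qˢ − 1) = ℓⁿ⁻¹ U, ℓ ∤ U. The translated orbit sum
-- A(y) = Σᵢ ζ^(Qⁱ W + y) is invariant under y ↦ y + ℓⁿ⁻¹ U (shift i by s), hence, U being a unit mod ℓ,
-- under y ↦ y + ℓⁿ⁻¹. So ℓ A(0) = Σ_{c<ℓ} A(c ℓⁿ⁻¹) = Σᵢ ζ^(Qⁱ W) Σ_{c<ℓ} ζ_ℓ^c = 0, and S = A(0) = 0.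

module Congruence where

  open import Data.Nat as ℕ using (ℕ; zero; suc; NonZero)
  import Data.Nat.DivMod as ℕ
  import Data.Nat.Divisibility as ℕ
  open import Data.Nat.Primality using (Prime; prime⇒irreducible)
  open import Data.Nat.Coprimality using (Coprime; coprime-Bézout)
  open import Data.Nat.GCD using (module Bézout)
  open import Data.Integer as ℤ using (ℤ; +_; -[1+_]; 0ℤ; 1ℤ; _+_; _*_; -_; _-_; _^_; _%ℕ_; _/ℕ_)
  import Data.Integer.Properties as ℤ
  open import Data.Integer.DivMod using (a≡a%ℕn+[a/ℕn]*n; n%ℕd<d)
  import Data.Integer.Divisibility as Unsigned
  open import Data.Integer.Divisibility.Signed
  open import Data.Integer.Tactic.RingSolver using (solve-∀)
  open import Data.Product using (Σ; _,_)
  open import Data.Sum using (inj₁; inj₂)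
  open import Function using (_∘_)
  open import Relation.Nullary using (¬_; contradiction)
  open import Relation.Binary.PropositionalEquality

  infix 4 _≡_mod_

  -- A record rather than a synonym for m ∣ x - y, so that x, y and m can be inferred from the type.
  record _≡_mod_ (x y m : ℤ) : Set where
    constructor ≡-mod
    field ∣-diff : m ∣ x - y
  open _≡_mod_ public

  ≡⇒≡-mod : ∀ {m x y} → x ≡ y → x ≡ y mod m
  ≡⇒≡-mod {x = x} refl = ≡-mod (divides 0ℤ (ℤ.+-inverseʳ x))

  ≡-mod-trans : ∀ {m x y z} → x ≡ y mod m → y ≡ z mod m → x ≡ z mod m
  ≡-mod-trans {x = x} {y} {z} (≡-mod p) (≡-mod q) = ≡-mod (subst (_ ∣_) (telescope x y z) (∣m∣n⇒∣m+n p q))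
    where telescope : ∀ x y z → (x - y) + (y - z) ≡ x - z
          telescope = solve-∀

  +-congʳ-mod : ∀ {m x y} c → x ≡ y mod m → x + c ≡ y + c mod m
  +-congʳ-mod {x = x} {y} c (≡-mod p) = ≡-mod (subst (_ ∣_) (cancel x y c) p)
    where cancel : ∀ x y c → x - y ≡ x + c - (y + c)
          cancel = solve-∀

  +-congˡ-mod : ∀ {m x y} c → x ≡ y mod m → c + x ≡ c + y mod m
  +-congˡ-mod {x = x} {y} c (≡-mod p) = ≡-mod (subst (_ ∣_) (cancel x y c) p)
    where cancel : ∀ x y c → x - y ≡ c + x - (c + y)
          cancel = solve-∀

  *-congˡ-mod : ∀ {m x y} c → x ≡ y mod m → c * x ≡ c * y mod m
  *-congˡ-mod {x = x} {y} c (≡-mod p) = ≡-mod (subst (_ ∣_) (distrib c x y) (∣n⇒∣m*n c p))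
    where distrib : ∀ c x y → c * (x - y) ≡ c * x - c * y
          distrib = solve-∀

  *-cong-mod : ∀ {m x y x′ y′} → x ≡ y mod m → x′ ≡ y′ mod m → x * x′ ≡ y * y′ mod m
  *-cong-mod {x = x} {y} {x′} {y′} (≡-mod p) (≡-mod q) =
    ≡-mod (subst (_ ∣_) (expand x y x′ y′) (∣m∣n⇒∣m+n (∣m⇒∣m*n x′ p) (∣n⇒∣m*n y q)))
    where expand : ∀ x y x′ y′ → (x - y) * x′ + y * (x′ - y′) ≡ x * x′ - y * y′
          expand = solve-∀

  ^-cong-mod : ∀ {m x y} → x ≡ y mod m → ∀ i → x ^ i ≡ y ^ i mod m
  ^-cong-mod p zero    = ≡⇒≡-mod refl
  ^-cong-mod p (suc i) = *-cong-mod p (^-cong-mod p i)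

  ^-≡1-mod : ∀ {m x} → x ≡ 1ℤ mod m → ∀ i → x ^ i ≡ 1ℤ mod m
  ^-≡1-mod {m} {x} x≡1 i = subst (λ y → x ^ i ≡ y mod m) (ℤ.^-zeroˡ i) (^-cong-mod x≡1 i)

  ≡1-mod-*ˡ : ∀ {m x} → x ≡ 1ℤ mod m → ∀ y → x * y ≡ y mod m
  ≡1-mod-*ˡ {m} {x} (≡-mod m∣x-1) y = ≡-mod (subst (m ∣_) (expand x y) (∣m⇒∣m*n y m∣x-1))
    where expand : ∀ x y → (x - 1ℤ) * y ≡ x * y - y
          expand = solve-∀

  ≡-mod-weaken : ∀ {m m′ x y} → m ∣ m′ → x ≡ y mod m′ → x ≡ y mod m
  ≡-mod-weaken m∣m′ (≡-mod p) = ≡-mod (∣-trans m∣m′ p)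

  remainder-unique-ℕ : ∀ {N r r′} m .{{_ : NonZero N}} → r ℕ.< N → r′ ℕ.< N →
                       r ≡ r′ ℕ.+ m ℕ.* N → r ≡ r′
  remainder-unique-ℕ {N} {r} {r′} m r<N r′<N r≡r′+mN = begin
    r                   ≡⟨ ℕ.m<n⇒m%n≡m r<N ⟨
    r ℕ.% N             ≡⟨ cong (ℕ._% N) r≡r′+mN ⟩
    (r′ ℕ.+ m ℕ.* N) ℕ.% N ≡⟨ ℕ.[m+kn]%n≡m%n r′ m N ⟩
    r′ ℕ.% N            ≡⟨ ℕ.m<n⇒m%n≡m r′<N ⟩
    r′                  ∎
    where open ≡-Reasoning

  remainder-unique : ∀ {N r r′} t .{{_ : NonZero N}} → r ℕ.< N → r′ ℕ.< N →
                     + r ≡ + r′ + t * + N → r ≡ r′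
  remainder-unique {N} {r} {r′} (+ m) r<N r′<N eq =
    remainder-unique-ℕ m r<N r′<N (ℤ.+-injective (begin
      + r                   ≡⟨ eq ⟩
      + r′ + + m * + N      ≡⟨ cong (λ x → + r′ + x) (ℤ.pos-* m N) ⟨
      + r′ + + (m ℕ.* N)    ≡⟨ ℤ.pos-+ r′ (m ℕ.* N) ⟨
      + (r′ ℕ.+ m ℕ.* N)    ∎))
    where open ≡-Reasoning
  remainder-unique {N} {r} {r′} -[1+ m ] r<N r′<N eq =
    sym (remainder-unique (+ suc m) r′<N r<N (trans (cancel (+ r′) (+ suc m) (+ N)) (cong (_+ + suc m * + N) (sym eq))))
    where cancel : ∀ r′ m N → r′ ≡ r′ + (- m) * N + m * N
          cancel = solve-∀

  %ℕ-cong : ∀ {N x y} .{{_ : NonZero N}} → x ≡ y mod + N → x %ℕ N ≡ y %ℕ N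
  %ℕ-cong {N} {x} {y} (≡-mod (divides t x-y≡tN)) =
    remainder-unique (y /ℕ N - x /ℕ N + t) (n%ℕd<d x N) (n%ℕd<d y N)
      (rearrange (+ (x %ℕ N)) (+ (y %ℕ N)) (x /ℕ N) (y /ℕ N) t (+ N)
        (trans (cong₂ _-_ (sym (a≡a%ℕn+[a/ℕn]*n x N)) (sym (a≡a%ℕn+[a/ℕn]*n y N))) x-y≡tN))
    where
    rearrange : ∀ rx ry qx qy t N → rx + qx * N - (ry + qy * N) ≡ t * N → rx ≡ ry + (qy - qx + t) * N
    rearrange rx ry qx qy t N h = begin
      rx                                                 ≡⟨ split rx ry qx qy N ⟩
      ry + (qy - qx) * N + (rx + qx * N - (ry + qy * N)) ≡⟨ cong (λ z → ry + (qy - qx) * N + z) h ⟩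
      ry + (qy - qx) * N + t * N                         ≡⟨ collect ry qx qy t N ⟩
      ry + (qy - qx + t) * N                             ∎
      where
      open ≡-Reasoning
      split : ∀ rx ry qx qy N → rx ≡ ry + (qy - qx) * N + (rx + qx * N - (ry + qy * N))
      split = solve-∀
      collect : ∀ ry qx qy t N → ry + (qy - qx) * N + t * N ≡ ry + (qy - qx + t) * N
      collect = solve-∀

  ≡-mod-%ℕ : ∀ {N} .{{_ : NonZero N}} z → z ≡ + (z %ℕ N) mod + N
  ≡-mod-%ℕ {N} z = ≡-mod (divides (z /ℕ N) (trans (cong (_- + (z %ℕ N)) (a≡a%ℕn+[a/ℕn]*n z N)) (cancel (+ (z %ℕ N)) (z /ℕ N * + N))))
    where cancel : ∀ r x → r + x - r ≡ x
          cancel = solve-∀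

  prime∤⇒coprime : ∀ {p n} → Prime p → ¬ p ℕ.∣ n → Coprime p n
  prime∤⇒coprime pr p∤n (d∣p , d∣n) with prime⇒irreducible pr d∣p
  ... | inj₁ d≡1  = d≡1
  ... | inj₂ refl = contradiction d∣n p∤n

  bézout⇒inverse : ∀ {p m} → Bézout.Identity 1 p m → Σ ℤ λ u → + m * u ≡ 1ℤ mod + p
  bézout⇒inverse {p} {m} (Bézout.+- x y eq) =
    - + y , ≡-mod (divides (- + x) (identity (+ m) (+ y) (+ p) (+ x) (lift eq)))
    where
    lift : 1 ℕ.+ y ℕ.* m ≡ x ℕ.* p → 1ℤ + + y * + m ≡ + x * + p
    lift eq = trans (cong (λ z → 1ℤ + z) (sym (ℤ.pos-* y m))) (trans (cong +_ eq) (ℤ.pos-* x p))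
    identity : ∀ m y p x → 1ℤ + y * m ≡ x * p → m * (- y) - 1ℤ ≡ (- x) * p
    identity m y p x h = trans (negate m y) (trans (cong -_ h) (ℤ.neg-distribˡ-* x p))
      where negate : ∀ m y → m * (- y) - 1ℤ ≡ - (1ℤ + y * m)
            negate = solve-∀
  bézout⇒inverse {p} {m} (Bézout.-+ x y eq) =
    + y , ≡-mod (divides (+ x) (identity (+ m) (+ y) (+ p) (+ x) (lift eq)))
    where
    lift : 1 ℕ.+ x ℕ.* p ≡ y ℕ.* m → 1ℤ + + x * + p ≡ + y * + m
    lift eq = trans (cong (λ z → 1ℤ + z) (sym (ℤ.pos-* x p))) (trans (cong +_ eq) (ℤ.pos-* y m))
    identity : ∀ m y p x → 1ℤ + x * p ≡ y * m → m * y - 1ℤ ≡ x * p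
    identity m y p x h = trans (cong (_- 1ℤ) (trans (ℤ.*-comm m y) (sym h))) (cancel x p)
      where cancel : ∀ x p → 1ℤ + x * p - 1ℤ ≡ x * p
            cancel = solve-∀

  inverse-mod-prime : ∀ {p} U → Prime p → ¬ (+ p ∣ U) → Σ ℤ λ u → U * u ≡ 1ℤ mod + p
  inverse-mod-prime {p} U pr p∤U with bézout⇒inverse (coprime-Bézout (prime∤⇒coprime pr (p∤U ∘ ∣ᵤ⇒∣)))
  inverse-mod-prime (+ m)    pr p∤U | u , mu≡1 = u , mu≡1
  inverse-mod-prime -[1+ m ] pr p∤U | u , mu≡1 = - u , subst (_≡ 1ℤ mod _) (negate (+ suc m) u) mu≡1
    where negate : ∀ m u → m * u ≡ (- m) * (- u)
          negate = solve-∀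

  fixed-mod-^ : ∀ {m x w} → x * w ≡ w mod m → ∀ i → x ^ i * w ≡ w mod m
  fixed-mod-^ {w = w} xw≡w zero    = ≡⇒≡-mod (ℤ.*-identityˡ w)
  fixed-mod-^ {m} {x} {w} xw≡w (suc i) =
    subst (_≡ w mod m) (sym (ℤ.*-assoc x (x ^ i) w)) (≡-mod-trans (*-congˡ-mod x (fixed-mod-^ xw≡w i)) xw≡w)

  ≡-mod⇒∣ᵤ : ∀ {m x y} → x ≡ y mod m → m Unsigned.∣ x - y
  ≡-mod⇒∣ᵤ = ∣⇒∣ᵤ ∘ ∣-diff

  ∣ᵤ⇒≡-mod : ∀ {m x y} → m Unsigned.∣ x - y → x ≡ y mod m
  ∣ᵤ⇒≡-mod = ≡-mod ∘ ∣ᵤ⇒∣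

  m∣m^[1+n] : ∀ m n → + m ∣ + (m ℕ.^ suc n)
  m∣m^[1+n] m n = divides (+ (m ℕ.^ n)) (trans (ℤ.pos-* m (m ℕ.^ n)) (ℤ.*-comm (+ m) _))

module FiniteSum where

  open import Data.Nat as ℕ using (ℕ; zero; suc; _<_; _≤_; s≤s)
  import Data.Nat.Properties as ℕ
  open import Data.Integer as ℤ using (ℤ; +_; 0ℤ; 1ℤ; _+_; _*_)
  import Data.Integer.Properties as ℤ
  open import Data.Integer.Tactic.RingSolver using (solve-∀)
  open import Algebra.Properties.AbelianGroup ℤ.+-0-abelianGroup using (∙-cancelʳ)
  open import Data.Bool using (if_then_else_)
  open import Relation.Nullary using (does; yes; no)
  open import Relation.Nullary.Decidable using (dec-false; dec-true)
  open import Relation.Binary.PropositionalEquality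
  open import Function using (_∘_)

  ∑ : ℕ → (ℕ → ℤ) → ℤ
  ∑ zero    f = 0ℤ
  ∑ (suc r) f = ∑ r f + f r

  syntax ∑ r (λ i → e) = ∑[ i < r ] e

  ∑-cong : ∀ r {f g} → (∀ i → i < r → f i ≡ g i) → ∑ r f ≡ ∑ r g
  ∑-cong zero    f≡g = refl
  ∑-cong (suc r) f≡g = cong₂ _+_ (∑-cong r λ i i<r → f≡g i (ℕ.m<n⇒m<1+n i<r)) (f≡g r ℕ.≤-refl)

  ∑-const : ∀ r c → ∑[ i < r ] c ≡ + r * c
  ∑-const zero    c = sym (ℤ.*-zeroˡ c)
  ∑-const (suc r) c = trans (cong (_+ c) (∑-const r c)) (step (+ r) c)
    where step : ∀ r c → r * c + c ≡ (1ℤ + r) * c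
          step = solve-∀

  ∑-zero : ∀ r → ∑[ i < r ] 0ℤ ≡ 0ℤ
  ∑-zero r = trans (∑-const r 0ℤ) (ℤ.*-zeroʳ (+ r))

  ∑-+ : ∀ r f g → ∑[ i < r ] (f i + g i) ≡ ∑ r f + ∑ r g
  ∑-+ zero    f g = refl
  ∑-+ (suc r) f g = trans (cong (_+ (f r + g r)) (∑-+ r f g)) (interchange (∑ r f) (∑ r g) (f r) (g r))
    where interchange : ∀ a b c d → a + b + (c + d) ≡ a + c + (b + d)
          interchange = solve-∀

  ∑-comm : ∀ r s (F : ℕ → ℕ → ℤ) → ∑[ i < r ] ∑[ j < s ] F i j ≡ ∑[ j < s ] ∑[ i < r ] F i j
  ∑-comm zero    s F = sym (∑-zero s)
  ∑-comm (suc r) s F = trans (cong (_+ ∑[ j < s ] F r j) (∑-comm r s F))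
                             (sym (∑-+ s (λ j → ∑[ i < r ] F i j) (F r)))

  ∑-rotate : ∀ r f → ∑[ i < r ] f (suc i) + f 0 ≡ ∑ r f + f r
  ∑-rotate zero    f = refl
  ∑-rotate (suc r) f = trans (swap (∑[ i < r ] f (suc i)) (f (suc r)) (f 0))
                             (cong (_+ f (suc r)) (∑-rotate r f))
    where swap : ∀ a b c → a + b + c ≡ a + c + b
          swap = solve-∀

  Periodic : ℕ → (ℕ → ℤ) → Set
  Periodic p f = ∀ i → f (p ℕ.+ i) ≡ f i

  periodic-* : ∀ {p f} → Periodic p f → ∀ j → Periodic (j ℕ.* p) f
  periodic-* per zero    i = refl
  periodic-* {p} {f} per (suc j) i = trans (cong f (ℕ.+-assoc p (j ℕ.* p) i))
                                           (trans (per (j ℕ.* p ℕ.+ i)) (periodic-* per j i))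

  ∑-periodic-suc : ∀ r {f} → Periodic r f → ∑[ i < r ] f (suc i) ≡ ∑ r f
  ∑-periodic-suc r {f} per = ∙-cancelʳ (f 0) _ _ (begin
    ∑[ i < r ] f (suc i) + f 0  ≡⟨ ∑-rotate r f ⟩
    ∑ r f + f r                 ≡⟨ cong (λ z → ∑ r f + z) (trans (cong f (sym (ℕ.+-identityʳ r))) (per 0)) ⟩
    ∑ r f + f 0                 ∎)
    where open ≡-Reasoning

  ∑-periodic-shift : ∀ r {f} → Periodic r f → ∀ s → ∑[ i < r ] f (s ℕ.+ i) ≡ ∑ r f
  ∑-periodic-shift r per zero    = refl
  ∑-periodic-shift r {f} per (suc s) =
    trans (∑-periodic-shift r {f ∘ suc} (λ i → trans (cong f (sym (ℕ.+-suc r i))) (per (suc i))) s)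
          (∑-periodic-suc r per)

  δ : ℕ → ℕ → ℤ
  δ a b = if does (a ℕ.≟ b) then 1ℤ else 0ℤ

  δ-≢ : ∀ {a b} → a ≢ b → δ a b ≡ 0ℤ
  δ-≢ {a} {b} a≢b rewrite dec-false (a ℕ.≟ b) a≢b = refl

  δ-refl : ∀ a → δ a a ≡ 1ℤ
  δ-refl a rewrite dec-true (a ℕ.≟ a) refl = refl

  δ-injective : ∀ (g : ℕ → ℕ) → (∀ {a b} → g a ≡ g b → a ≡ b) → ∀ a b → δ (g a) (g b) ≡ δ a b
  δ-injective g g-inj a b with a ℕ.≟ b
  ... | yes refl = trans (δ-refl (g a)) (sym (δ-refl a))
  ... | no a≢b   = trans (δ-≢ (a≢b ∘ g-inj)) (sym (δ-≢ a≢b))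

  ∑-δ-≥ : ∀ m {c₀} → m ≤ c₀ → ∑[ c < m ] δ c₀ c ≡ 0ℤ
  ∑-δ-≥ zero    m≤c₀ = refl
  ∑-δ-≥ (suc m) m<c₀ = cong₂ _+_ (∑-δ-≥ m (ℕ.<⇒≤ m<c₀)) (δ-≢ (ℕ.>⇒≢ m<c₀))

  ∑-δ : ∀ m {c₀} → c₀ < m → ∑[ c < m ] δ c₀ c ≡ 1ℤ
  ∑-δ (suc m) {c₀} (s≤s c₀≤m) with c₀ ℕ.≟ m
  ... | yes refl = cong₂ _+_ (∑-δ-≥ m ℕ.≤-refl) (δ-refl m)
  ... | no c₀≢m  = cong₂ _+_ (∑-δ m (ℕ.≤∧≢⇒< c₀≤m c₀≢m)) (δ-≢ c₀≢m)

module LiftingTheExponent where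

  open import Data.Nat as ℕ using (ℕ; zero; suc; _<_; _≤_)
  import Data.Nat.Properties as ℕ
  import Data.Nat.Divisibility as ℕ
  import Data.Nat.Tactic.RingSolver as ℕ-Solver
  open import Data.Integer as ℤ using (ℤ; +_; 0ℤ; 1ℤ; _+_; _*_; -_; _-_; _^_)
  import Data.Integer.Properties as ℤ
  open import Data.Integer.Divisibility.Signed
  open import Data.Integer.Tactic.RingSolver using (solve-∀)
  open import Data.Product using (Σ; _×_; _,_)
  open import Data.Empty using (⊥-elim)
  open import Function using (_∘_)
  open import Relation.Nullary using (¬_; yes; no)
  open import Relation.Binary.PropositionalEquality
  open Congruence

  ∤2⇒odd : ∀ ℓ → ¬ 2 ℕ.∣ ℓ → Σ ℕ λ h → ℓ ≡ suc (2 ℕ.* h)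
  ∤2⇒odd zero          ∤ = ⊥-elim (∤ (ℕ.divides 0 refl))
  ∤2⇒odd (suc zero)    ∤ = 0 , refl
  ∤2⇒odd (suc (suc ℓ)) ∤ with ∤2⇒odd ℓ (∤ ∘ ℕ.∣m∣n⇒∣m+n ℕ.∣-refl)
  ... | h , refl = suc h , double h
    where double : ∀ h → suc (suc (suc (2 ℕ.* h))) ≡ suc (2 ℕ.* suc h)
          double = ℕ-Solver.solve-∀

  triangle : ℕ → ℕ
  triangle zero    = 0
  triangle (suc j) = triangle j ℕ.+ j

  triangle-double : ∀ m → triangle m ℕ.* 2 ℕ.+ m ≡ m ℕ.* m
  triangle-double zero    = refl
  triangle-double (suc m) = begin
    (triangle m ℕ.+ m) ℕ.* 2 ℕ.+ suc m         ≡⟨ regroup (triangle m) m ⟩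
    triangle m ℕ.* 2 ℕ.+ m ℕ.+ (2 ℕ.* m ℕ.+ 1) ≡⟨ cong (ℕ._+ (2 ℕ.* m ℕ.+ 1)) (triangle-double m) ⟩
    m ℕ.* m ℕ.+ (2 ℕ.* m ℕ.+ 1)               ≡⟨ square m ⟩
    suc m ℕ.* suc m                            ∎
    where
    open ≡-Reasoning
    regroup : ∀ t m → (t ℕ.+ m) ℕ.* 2 ℕ.+ suc m ≡ t ℕ.* 2 ℕ.+ m ℕ.+ (2 ℕ.* m ℕ.+ 1)
    regroup = ℕ-Solver.solve-∀
    square : ∀ m → m ℕ.* m ℕ.+ (2 ℕ.* m ℕ.+ 1) ≡ suc m ℕ.* suc m
    square = ℕ-Solver.solve-∀

  triangle-odd : ∀ h → triangle (suc (2 ℕ.* h)) ≡ suc (2 ℕ.* h) ℕ.* h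
  triangle-odd h = ℕ.*-cancelʳ-≡ _ _ 2 (ℕ.+-cancelʳ-≡ (suc (2 ℕ.* h)) _ _
    (trans (triangle-double (suc (2 ℕ.* h))) (square h)))
    where square : ∀ h → suc (2 ℕ.* h) ℕ.* suc (2 ℕ.* h) ≡ suc (2 ℕ.* h) ℕ.* h ℕ.* 2 ℕ.+ suc (2 ℕ.* h)
          square = ℕ-Solver.solve-∀

  binomial-mod-cube : ∀ X j → Σ ℤ λ B → (1ℤ + X) ^ j ≡ 1ℤ + + j * X + + triangle j * X * X + X * X * X * B
  binomial-mod-cube X zero    = 0ℤ , constant X
    where constant : ∀ X → 1ℤ ≡ 1ℤ + 0ℤ * X + 0ℤ * X * X + X * X * X * 0ℤ
          constant = solve-∀
  binomial-mod-cube X (suc j) with binomial-mod-cube X j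
  ... | B , expand = + triangle j + B + B * X , trans (cong ((1ℤ + X) *_) expand) (step X (+ j) (+ triangle j) B)
    where step : ∀ X j T B → (1ℤ + X) * (1ℤ + j * X + T * X * X + X * X * X * B)
                             ≡ 1ℤ + (1ℤ + j) * X + (T + j) * X * X + X * X * X * (T + B + B * X)
          step = solve-∀

  lte-step : ∀ {ℓ Q} h → ℓ ≡ suc (2 ℕ.* h) → Q ≡ 1ℤ mod + ℓ →
             Σ ℤ λ V → Q ^ ℓ - 1ℤ ≡ (Q - 1ℤ) * + ℓ * V × (V ≡ 1ℤ mod + ℓ)
  lte-step {ℓ} {Q} h ℓ-odd (≡-mod (divides Y Q-1≡Yℓ)) with binomial-mod-cube (Q - 1ℤ) ℓ
  ... | B , expand = 1ℤ + + ℓ * (+ h * Y + Y * Y * B) , (begin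
        Q ^ ℓ - 1ℤ                                    ≡⟨ cong (λ x → x ^ ℓ - 1ℤ) (one-plus Q) ⟩
        (1ℤ + (Q - 1ℤ)) ^ ℓ - 1ℤ                      ≡⟨ cong (_- 1ℤ) expand ⟩
        1ℤ + + ℓ * X + + triangle ℓ * X * X + X * X * X * B - 1ℤ
                                                      ≡⟨ cong (λ T → 1ℤ + + ℓ * X + T * X * X + X * X * X * B - 1ℤ) triangleℓ ⟩
        1ℤ + + ℓ * X + + ℓ * + h * X * X + X * X * X * B - 1ℤ
                                                      ≡⟨ factor X Y (+ ℓ) (+ h) B Q-1≡Yℓ ⟩
        X * + ℓ * (1ℤ + + ℓ * (+ h * Y + Y * Y * B))  ∎)
      , ≡-mod (divides (+ h * Y + Y * Y * B) (unit (+ ℓ) (+ h * Y + Y * Y * B)))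
    where
    open ≡-Reasoning
    X = Q - 1ℤ
    one-plus : ∀ Q → Q ≡ 1ℤ + (Q - 1ℤ)
    one-plus = solve-∀
    triangleℓ : + triangle ℓ ≡ + ℓ * + h
    triangleℓ = trans (cong +_ (trans (cong triangle ℓ-odd) (trans (triangle-odd h) (cong (ℕ._* h) (sym ℓ-odd))))) (ℤ.pos-* ℓ h)
    factor : ∀ X Y L H B → X ≡ Y * L →
             1ℤ + L * X + L * H * X * X + X * X * X * B - 1ℤ ≡ X * L * (1ℤ + L * (H * Y + Y * Y * B))
    factor _ Y L H B refl = expanded Y L H B
      where expanded : ∀ Y L H B → 1ℤ + L * (Y * L) + L * H * (Y * L) * (Y * L) + (Y * L) * (Y * L) * (Y * L) * B - 1ℤ
                                   ≡ (Y * L) * L * (1ℤ + L * (H * Y + Y * Y * B))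
            expanded = solve-∀
    unit : ∀ L Z → 1ℤ + L * Z - 1ℤ ≡ Z * L
    unit = solve-∀

  lte : ∀ {ℓ Q} h → ℓ ≡ suc (2 ℕ.* h) → Q ≡ 1ℤ mod + ℓ → ∀ t →
        Σ ℤ λ V → Q ^ (ℓ ℕ.^ t) - 1ℤ ≡ (Q - 1ℤ) * + (ℓ ℕ.^ t) * V × (V ≡ 1ℤ mod + ℓ)
  lte {Q = Q} h ℓ-odd Q≡1 zero = 1ℤ , base Q , ≡⇒≡-mod refl
    where base : ∀ Q → Q * 1ℤ - 1ℤ ≡ (Q - 1ℤ) * 1ℤ * 1ℤ
          base = solve-∀
  lte {ℓ} {Q} h ℓ-odd Q≡1 (suc t) with lte h ℓ-odd Q≡1 t | lte-step h ℓ-odd (^-≡1-mod Q≡1 (ℓ ℕ.^ t))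
  ... | V , Qᵗ-1≡ , V≡1 | V′ , Qᵗℓ-1≡ , V′≡1 = V * V′ , (begin
        Q ^ (ℓ ℕ.* ℓ ℕ.^ t) - 1ℤ                          ≡⟨ cong (_- 1ℤ) power ⟩
        (Q ^ (ℓ ℕ.^ t)) ^ ℓ - 1ℤ                          ≡⟨ Qᵗℓ-1≡ ⟩
        (Q ^ (ℓ ℕ.^ t) - 1ℤ) * + ℓ * V′                   ≡⟨ cong (λ x → x * + ℓ * V′) Qᵗ-1≡ ⟩
        (Q - 1ℤ) * + (ℓ ℕ.^ t) * V * + ℓ * V′             ≡⟨ regroup (Q - 1ℤ) (+ (ℓ ℕ.^ t)) V (+ ℓ) V′ ⟩
        (Q - 1ℤ) * (+ ℓ * + (ℓ ℕ.^ t)) * (V * V′)         ≡⟨ cong (λ x → (Q - 1ℤ) * x * (V * V′)) (ℤ.pos-* ℓ (ℓ ℕ.^ t)) ⟨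
        (Q - 1ℤ) * + (ℓ ℕ.* ℓ ℕ.^ t) * (V * V′)           ∎)
      , *-cong-mod V≡1 V′≡1
    where
    open ≡-Reasoning
    power : Q ^ (ℓ ℕ.* ℓ ℕ.^ t) ≡ (Q ^ (ℓ ℕ.^ t)) ^ ℓ
    power = trans (cong (Q ^_) (ℕ.*-comm ℓ (ℓ ℕ.^ t))) (sym (ℤ.^-*-assoc Q (ℓ ℕ.^ t) ℓ))
    regroup : ∀ X P V L V′ → X * P * V * L * V′ ≡ X * (L * P) * (V * V′)
    regroup = solve-∀

  split-prime-power : ∀ ℓ b E → ¬ (+ (ℓ ℕ.^ b) ∣ E) →
                      Σ ℕ λ a → a < b × Σ ℤ λ U → E ≡ + (ℓ ℕ.^ a) * U × ¬ (+ ℓ ∣ U)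
  split-prime-power ℓ zero    E ∤E = ⊥-elim (∤E (divides E (sym (ℤ.*-identityʳ E))))
  split-prime-power ℓ (suc b) E ∤E with + (ℓ ℕ.^ b) ∣? E
  ... | no ∤′E with split-prime-power ℓ b E ∤′E
  ...   | a , a<b , U , E≡ , ∤U = a , ℕ.m<n⇒m<1+n a<b , U , E≡ , ∤U
  split-prime-power ℓ (suc b) E ∤E | yes (divides U E≡Uℓᵇ) with + ℓ ∣? U
  ... | no ∤U = b , ℕ.≤-refl , U , trans E≡Uℓᵇ (ℤ.*-comm U _) , ∤U
  ... | yes (divides V U≡Vℓ) = ⊥-elim (∤E (divides V (begin
        E                          ≡⟨ E≡Uℓᵇ ⟩
        U * + (ℓ ℕ.^ b)            ≡⟨ cong (_* + (ℓ ℕ.^ b)) U≡Vℓ ⟩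
        V * + ℓ * + (ℓ ℕ.^ b)      ≡⟨ ℤ.*-assoc V (+ ℓ) _ ⟩
        V * (+ ℓ * + (ℓ ℕ.^ b))    ≡⟨ cong (V *_) (ℤ.pos-* ℓ (ℓ ℕ.^ b)) ⟨
        V * + (ℓ ℕ.^ suc b)        ∎)))
    where open ≡-Reasoning

  ∤-*-unit : ∀ {m U V} → ¬ (m ∣ U) → V ≡ 1ℤ mod m → ¬ (m ∣ U * V)
  ∤-*-unit {m} {U} {V} ∤U (≡-mod m∣V-1) m∣UV = ∤U (∣m+n∣m⇒∣n (subst (m ∣_) (split U V) m∣UV) (∣n⇒∣m*n U m∣V-1))
    where split : ∀ U V → U * V ≡ U * (V - 1ℤ) + U
          split = solve-∀

  lte-exact-level : ∀ {ℓ Q} h W n → ℓ ≡ suc (2 ℕ.* h) → Q ≡ 1ℤ mod + ℓ → ¬ (+ (ℓ ℕ.^ suc n) ∣ Q * W - W) →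
                    Σ ℕ λ s → Σ ℤ λ U → W * (Q ^ s - 1ℤ) ≡ + (ℓ ℕ.^ n) * U × ¬ (+ ℓ ∣ U)
  lte-exact-level {ℓ} {Q} h W n ℓ-odd Q≡1 W-moves with split-prime-power ℓ (suc n) (Q * W - W) W-moves
  ... | a , a<1+n , U , QW-W≡ , ∤U with lte h ℓ-odd Q≡1 (n ℕ.∸ a)
  ...   | V , Qˢ-1≡ , V≡1 = ℓ ℕ.^ t , U * V , (begin
          W * (Q ^ ℓ ℕ.^ t - 1ℤ)                         ≡⟨ cong (W *_) Qˢ-1≡ ⟩
          W * ((Q - 1ℤ) * + (ℓ ℕ.^ t) * V)               ≡⟨ regroup W Q (+ (ℓ ℕ.^ t)) V ⟩
          (Q * W - W) * + (ℓ ℕ.^ t) * V                  ≡⟨ cong (λ x → x * + (ℓ ℕ.^ t) * V) QW-W≡ ⟩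
          + (ℓ ℕ.^ a) * U * + (ℓ ℕ.^ t) * V              ≡⟨ regroup′ (+ (ℓ ℕ.^ a)) U (+ (ℓ ℕ.^ t)) V ⟩
          + (ℓ ℕ.^ a) * + (ℓ ℕ.^ t) * (U * V)            ≡⟨ cong (_* (U * V)) (ℤ.pos-* (ℓ ℕ.^ a) (ℓ ℕ.^ t)) ⟨
          + (ℓ ℕ.^ a ℕ.* ℓ ℕ.^ t) * (U * V)              ≡⟨ cong (λ x → + x * (U * V)) (ℕ.^-distribˡ-+-* ℓ a t) ⟨
          + (ℓ ℕ.^ (a ℕ.+ t)) * (U * V)                  ≡⟨ cong (λ x → + (ℓ ℕ.^ x) * (U * V)) (ℕ.m+[n∸m]≡n (ℕ.≤-pred a<1+n)) ⟩
          + (ℓ ℕ.^ n) * (U * V)                          ∎)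
        , ∤-*-unit ∤U V≡1
    where
    open ≡-Reasoning
    t = n ℕ.∸ a
    regroup : ∀ W Q P V → W * ((Q - 1ℤ) * P * V) ≡ (Q * W - W) * P * V
    regroup = solve-∀
    regroup′ : ∀ A U P V → A * U * P * V ≡ A * P * (U * V)
    regroup′ = solve-∀

module PowerBasis where

  open import Defs
  open import Data.Nat as ℕ using (ℕ; zero; suc; NonZero; _<_; _≤_; _∸_)
  import Data.Nat.Properties as ℕ
  import Data.Nat.DivMod as ℕ
  import Data.Nat.Tactic.RingSolver as ℕ-Solver
  open import Data.Integer as ℤ using (ℤ; +_; 0ℤ; 1ℤ; _+_; _*_; -_; _%ℕ_)
  import Data.Integer.Properties as ℤ
  open import Data.Integer.DivMod using (n%ℕd<d)
  open import Data.Fin using (toℕ)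
  import Data.Fin.Properties as Fin
  open import Relation.Nullary using (yes; no)
  open import Relation.Nullary.Decidable using (dec-true; dec-false)
  open import Relation.Binary.PropositionalEquality
  open Congruence
  open FiniteSum

  module _ (ℓ : ℕ) .{{_ : NonZero ℓ}} where
    open Cyclotomic ℓ

    ζ^ₐ-cong : ∀ n {x y} → x ≡ y mod + (ℓ ℕ.^ n) → ζ^ₐ n x ≡ ζ^ₐ n y
    ζ^ₐ-cong n x≡y = cong (ζpow n) (%ℕ-cong {{ℕ.m^n≢0 ℓ n}} x≡y)

    ζpow-below : ∀ n {j} e → j < φ n → ζpow n j e ≡ δ (toℕ e) j
    ζpow-below n {j} e j<φ rewrite dec-true (j ℕ.<? φ n) j<φ = refl

    Σ₁≡∑ : ∀ n r f e → Σ₁ n r f e ≡ ∑[ i < r ] f (suc i) e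
    Σ₁≡∑ n zero    f e = refl
    Σ₁≡∑ n (suc r) f e = cong (_+ f (suc r) e) (Σ₁≡∑ n r f e)

  -- The ℓ-th roots of unity in ℤ[ζ_N], N = ℓ^(n + 1), are the powers ζ^(c d), d = ℓⁿ.
  module RootsOfUnity (L n : ℕ) where
    ℓ d N : ℕ
    ℓ = suc L
    d = ℓ ℕ.^ n
    N = ℓ ℕ.^ suc n

    instance
      d≢0 : NonZero d
      d≢0 = ℕ.m^n≢0 ℓ n
      N≢0 : NonZero N
      N≢0 = ℕ.m^n≢0 ℓ (suc n)

    open Cyclotomic ℓ

    ζpow-top : ∀ {r} e → r < d → ζpow (suc n) (r ℕ.+ L ℕ.* d) e ≡ - δ (toℕ e ℕ.% d) r
    ζpow-top {r} e r<d
      rewrite dec-false (r ℕ.+ L ℕ.* d ℕ.<? L ℕ.* d) (ℕ.≤⇒≯ (ℕ.m≤n+m (L ℕ.* d) r))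
            | ℕ.m+n∸n≡m r (L ℕ.* d)
      with toℕ e ℕ.% d ℕ.≟ r
    ... | yes E%d≡r rewrite dec-true (toℕ e ℕ.% d ℕ.≟ r) E%d≡r = refl
    ... | no  E%d≢r rewrite dec-false (toℕ e ℕ.% d ℕ.≟ r) E%d≢r = refl

    ∑-δ-coset : ∀ {E r} → E < L ℕ.* d → r < d → ∑[ c < L ] δ E (r ℕ.+ c ℕ.* d) ≡ δ (E ℕ.% d) r
    ∑-δ-coset {E} {r} E<Ld r<d with E ℕ.% d ℕ.≟ r
    ... | yes E%d≡r = begin
      ∑[ c < L ] δ E (r ℕ.+ c ℕ.* d)                   ≡⟨ ∑-cong L (λ c _ → cong (λ x → δ x (r ℕ.+ c ℕ.* d)) E≡) ⟩
      ∑[ c < L ] δ (r ℕ.+ c₀ ℕ.* d) (r ℕ.+ c ℕ.* d)    ≡⟨ ∑-cong L (λ c _ → δ-injective (λ c → r ℕ.+ c ℕ.* d) coset-injective c₀ c) ⟩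
      ∑[ c < L ] δ c₀ c                                ≡⟨ ∑-δ L (ℕ.m<n*o⇒m/o<n E<Ld) ⟩
      1ℤ                                               ≡⟨ δ-refl r ⟨
      δ r r                                            ≡⟨ cong (λ x → δ x r) E%d≡r ⟨
      δ (E ℕ.% d) r                                    ∎
      where
      open ≡-Reasoning
      c₀ = E ℕ./ d
      E≡ : E ≡ r ℕ.+ c₀ ℕ.* d
      E≡ = trans (ℕ.m≡m%n+[m/n]*n E d) (cong (ℕ._+ c₀ ℕ.* d) E%d≡r)
      coset-injective : ∀ {a b} → r ℕ.+ a ℕ.* d ≡ r ℕ.+ b ℕ.* d → a ≡ b
      coset-injective {a} {b} eq = ℕ.*-cancelʳ-≡ a b d (ℕ.+-cancelˡ-≡ r _ _ eq)
    ... | no E%d≢r = trans (∑-cong L (λ c _ → δ-≢ (λ E≡ → E%d≢r (remainder c E≡)))) (trans (∑-zero L) (sym (δ-≢ E%d≢r)))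
      where
      remainder : ∀ c → E ≡ r ℕ.+ c ℕ.* d → E ℕ.% d ≡ r
      remainder c E≡ = trans (cong (ℕ._% d) E≡) (trans (ℕ.[m+kn]%n≡m%n r c d) (ℕ.m<n⇒m%n≡m r<d))

    ∑-ζpow-coset : ∀ {r} e → r < d → ∑[ c < ℓ ] ζpow (suc n) (r ℕ.+ c ℕ.* d) e ≡ 0ℤ
    ∑-ζpow-coset {r} e r<d = begin
      ∑[ c < L ] ζpow (suc n) (r ℕ.+ c ℕ.* d) e + ζpow (suc n) (r ℕ.+ L ℕ.* d) e
        ≡⟨ cong₂ _+_ (∑-cong L λ c c<L → ζpow-below ℓ (suc n) e (below c<L)) (ζpow-top e r<d) ⟩
      ∑[ c < L ] δ (toℕ e) (r ℕ.+ c ℕ.* d) + - δ (toℕ e ℕ.% d) r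
        ≡⟨ cong (_+ - δ (toℕ e ℕ.% d) r) (∑-δ-coset (Fin.toℕ<n e) r<d) ⟩
      δ (toℕ e ℕ.% d) r + - δ (toℕ e ℕ.% d) r
        ≡⟨ ℤ.+-inverseʳ (δ (toℕ e ℕ.% d) r) ⟩
      0ℤ ∎
      where
      open ≡-Reasoning
      below : ∀ {c} → c < L → r ℕ.+ c ℕ.* d < L ℕ.* d
      below c<L = ℕ.≤-trans (ℕ.+-monoˡ-< _ r<d) (ℕ.*-monoˡ-≤ d c<L)

    ∑-ζpow-rotate : ∀ {y} e → y < N →
                    ∑[ c < ℓ ] ζpow (suc n) ((y ℕ.+ c ℕ.* d) ℕ.% N) e ≡ ∑[ c < ℓ ] ζpow (suc n) (y ℕ.% d ℕ.+ c ℕ.* d) e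
    ∑-ζpow-rotate {y} e y<N = begin
      ∑ ℓ g                                      ≡⟨ ∑-periodic-shift ℓ g-periodic b ⟨
      ∑[ c < ℓ ] g (b ℕ.+ c)                     ≡⟨ ∑-cong ℓ (λ c c<ℓ → cong (λ j → ζpow (suc n) j e) (rotate c<ℓ)) ⟩
      ∑[ c < ℓ ] ζpow (suc n) (r ℕ.+ c ℕ.* d) e  ∎
      where
      open ≡-Reasoning
      r = y ℕ.% d
      a = y ℕ./ d
      b = ℓ ∸ a
      g : ℕ → ℤ
      g c = ζpow (suc n) ((y ℕ.+ c ℕ.* d) ℕ.% N) e

      g-periodic : Periodic ℓ g
      g-periodic c = cong (λ j → ζpow (suc n) j e)
        (trans (cong (ℕ._% N) (shift y c ℓ d)) (ℕ.[m+n]%n≡m%n (y ℕ.+ c ℕ.* d) N))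
        where shift : ∀ y c ℓ d → y ℕ.+ (ℓ ℕ.+ c) ℕ.* d ≡ y ℕ.+ c ℕ.* d ℕ.+ ℓ ℕ.* d
              shift = ℕ-Solver.solve-∀

      rotate : ∀ {c} → c < ℓ → (y ℕ.+ (b ℕ.+ c) ℕ.* d) ℕ.% N ≡ r ℕ.+ c ℕ.* d
      rotate {c} c<ℓ = begin
        (y ℕ.+ (b ℕ.+ c) ℕ.* d) ℕ.% N                ≡⟨ cong (λ x → (x ℕ.+ (b ℕ.+ c) ℕ.* d) ℕ.% N) (ℕ.m≡m%n+[m/n]*n y d) ⟩
        (r ℕ.+ a ℕ.* d ℕ.+ (b ℕ.+ c) ℕ.* d) ℕ.% N    ≡⟨ cong (ℕ._% N) (regroup r a b c d) ⟩
        (r ℕ.+ c ℕ.* d ℕ.+ (a ℕ.+ b) ℕ.* d) ℕ.% N    ≡⟨ cong (λ x → (r ℕ.+ c ℕ.* d ℕ.+ x ℕ.* d) ℕ.% N) (ℕ.m+[n∸m]≡n a≤ℓ) ⟩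
        (r ℕ.+ c ℕ.* d ℕ.+ ℓ ℕ.* d) ℕ.% N            ≡⟨ ℕ.[m+n]%n≡m%n (r ℕ.+ c ℕ.* d) N ⟩
        (r ℕ.+ c ℕ.* d) ℕ.% N                        ≡⟨ ℕ.m<n⇒m%n≡m (ℕ.≤-trans (ℕ.+-monoˡ-< _ (ℕ.m%n<n y d)) (ℕ.*-monoˡ-≤ d c<ℓ)) ⟩
        r ℕ.+ c ℕ.* d                                ∎
        where
        a≤ℓ : a ≤ ℓ
        a≤ℓ = ℕ.<⇒≤ (ℕ.m<n*o⇒m/o<n y<N)
        regroup : ∀ r a b c d → r ℕ.+ a ℕ.* d ℕ.+ (b ℕ.+ c) ℕ.* d ≡ r ℕ.+ c ℕ.* d ℕ.+ (a ℕ.+ b) ℕ.* d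
        regroup = ℕ-Solver.solve-∀

    ∑-roots-of-unity : ∀ z e → ∑[ c < ℓ ] ζ^ₐ (suc n) (z + + c * + d) e ≡ 0ℤ
    ∑-roots-of-unity z e = begin
      ∑[ c < ℓ ] ζ^ₐ (suc n) (z + + c * + d) e                  ≡⟨ ∑-cong ℓ (λ c _ → cong (λ v → v e) (ζ^ₐ-cong ℓ (suc n) (reduce c))) ⟩
      ∑[ c < ℓ ] ζpow (suc n) ((y ℕ.+ c ℕ.* d) ℕ.% N) e          ≡⟨ ∑-ζpow-rotate e (n%ℕd<d z N) ⟩
      ∑[ c < ℓ ] ζpow (suc n) (y ℕ.% d ℕ.+ c ℕ.* d) e            ≡⟨ ∑-ζpow-coset e (ℕ.m%n<n y d) ⟩
      0ℤ                                                        ∎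
      where
      open ≡-Reasoning
      y = z %ℕ N
      reduce : ∀ c → z + + c * + d ≡ + (y ℕ.+ c ℕ.* d) mod + N
      reduce c = subst (λ x → z + + c * + d ≡ x mod + N)
                       (trans (cong (λ x → + y + x) (sym (ℤ.pos-* c d))) (sym (ℤ.pos-+ y (c ℕ.* d))))
                       (+-congʳ-mod (+ c * + d) (≡-mod-%ℕ z))

module AdicApproximation where

  open import Defs
  open import Data.Nat as ℕ using (ℕ; zero; suc; NonZero)
  open import Data.Integer as ℤ using (ℤ; +_; 1ℤ; _*_; _-_)
  import Data.Integer.Divisibility as Unsigned
  open import Data.Product using (_,_)
  open import Function using (_∘_)
  open import Relation.Binary.PropositionalEquality
  open Congruence

  module _ (ℓ : ℕ) .{{_ : NonZero ℓ}} where
    open Cyclotomic ℓ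

    approx-≡1 : (q : ℤ-adic ℓ) → + (ℓ ℕ.^ 1) Unsigned.∣ approx q 1 - 1ℤ → ∀ m → approx q (suc m) ≡ 1ℤ mod + ℓ
    approx-≡1 q q₁≡1 zero    = ≡-mod-weaken (m∣m^[1+n] ℓ 0) (∣ᵤ⇒≡-mod q₁≡1)
    approx-≡1 q q₁≡1 (suc m) = ≡-mod-trans (≡-mod-weaken (m∣m^[1+n] ℓ m) (∣ᵤ⇒≡-mod (compat q (suc m)))) (approx-≡1 q q₁≡1 m)

    constant : ℤ → ℤ-adic ℓ
    constant c = record { approx = λ _ → c ; compat = λ m → ≡-mod⇒∣ᵤ {+ (ℓ ℕ.^ m)} {c} (≡⇒≡-mod refl) }

    divisible-exact : ∀ n ρ {v : ℤζ n} (c : ℤζ n) → (∀ e → v e ≡ + ρ * c e) → DivisibleInℤₗζ n ρ v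
    divisible-exact n ρ c v≡ρc = (constant ∘ c) , λ e m → ≡-mod⇒∣ᵤ {+ (ℓ ℕ.^ m)} (≡⇒≡-mod (sym (v≡ρc e)))

module OrbitSum where

  open import Defs
  open import Data.Nat as ℕ using (ℕ; zero; suc; NonZero)
  import Data.Nat.Divisibility as ℕ
  open import Data.Nat.Primality using (Prime; ¬prime[0])
  open import Data.Integer as ℤ using (ℤ; +_; -[1+_]; 0ℤ; 1ℤ; _+_; _*_; -_; _-_; _^_)
  import Data.Integer.Properties as ℤ
  import Data.Integer.Divisibility as Unsigned
  open import Data.Integer.Divisibility.Signed using (_∣_; divides)
  open import Data.Integer.Tactic.RingSolver using (solve-∀)
  open import Data.Fin using (Fin)
  open import Data.Product using (_,_)
  open import Data.Empty using (⊥-elim)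
  open import Relation.Nullary using (¬_)
  open import Relation.Binary.PropositionalEquality
  open Congruence
  open FiniteSum
  open LiftingTheExponent
  open PowerBasis
  open AdicApproximation

  module _ {B : Set} {A : ℤ → B} where

    invariant-ℕ-multiples : ∀ {D} → (∀ y → A (y + D) ≡ A y) → ∀ m y → A (y + + m * D) ≡ A y
    invariant-ℕ-multiples {D} inv zero    y = cong A (vanish y D)
      where vanish : ∀ y D → y + 0ℤ * D ≡ y
            vanish = solve-∀
    invariant-ℕ-multiples {D} inv (suc m) y =
      trans (cong A (step y (+ m) D)) (trans (inv (y + + m * D)) (invariant-ℕ-multiples inv m y))
      where step : ∀ y m D → y + (1ℤ + m) * D ≡ y + m * D + D
            step = solve-∀

    invariant-multiples : ∀ {D} → (∀ y → A (y + D) ≡ A y) → ∀ J y → A (y + J * D) ≡ A y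
    invariant-multiples inv (+ m)    y = invariant-ℕ-multiples inv m y
    invariant-multiples {D} inv -[1+ m ] y =
      trans (sym (invariant-ℕ-multiples inv (suc m) (y + -[1+ m ] * D))) (cong A (cancel y (+ suc m) D))
      where cancel : ∀ y M D → y + (- M) * D + M * D ≡ y
            cancel = solve-∀

    invariant-coset : ∀ {m d U u} → (∀ {y y′} → y ≡ y′ mod (m * d) → A y ≡ A y′) →
                      (∀ y → A (y + d * U) ≡ A y) → U * u ≡ 1ℤ mod m → ∀ c y → A (y + c * d) ≡ A y
    invariant-coset {m} {d} {U} {u} A-cong inv (≡-mod (divides t Uu-1≡tm)) c y =
      trans (A-cong multiple) (invariant-multiples inv (c * u) y)
      where
      open ≡-Reasoning
      factor : ∀ y c d U u → y + c * d - (y + c * u * (d * U)) ≡ - (c * d) * (U * u - 1ℤ)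
      factor = solve-∀
      regroup : ∀ c d t m → - (c * d) * (t * m) ≡ - (c * t) * (m * d)
      regroup = solve-∀
      multiple : y + c * d ≡ y + c * u * (d * U) mod (m * d)
      multiple = ≡-mod (divides (- (c * t)) (begin
        y + c * d - (y + c * u * (d * U))  ≡⟨ factor y c d U u ⟩
        - (c * d) * (U * u - 1ℤ)           ≡⟨ cong (λ x → - (c * d) * x) Uu-1≡tm ⟩
        - (c * d) * (t * m)                ≡⟨ regroup c d t m ⟩
        - (c * t) * (m * d)                ∎))

  module Vanishing (L n : ℕ) (Q W : ℤ) (Q≡1 : Q ≡ 1ℤ mod + suc L)
                  (k : ℕ) (Qᵏ≡1 : Q ^ k ≡ 1ℤ mod + (suc L ℕ.^ suc n))
                  (s : ℕ) (U u : ℤ) (W[Qˢ-1]≡dU : W * (Q ^ s - 1ℤ) ≡ + (suc L ℕ.^ n) * U)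
                  (Uu≡1 : U * u ≡ 1ℤ mod + suc L) where

    open RootsOfUnity L n
    open Cyclotomic ℓ

    N≡ℓd : + N ≡ + ℓ * + d
    N≡ℓd = ℤ.pos-* ℓ d

    module _ (j : ℕ) (e : Fin (φ (suc n))) where

      ρ : ℕ
      ρ = j ℕ.* k

      T : ℤ → ℤ
      T z = ζ^ₐ (suc n) z e

      T-cong : ∀ {x y} → x ≡ y mod + N → T x ≡ T y
      T-cong x≡y = cong (λ v → v e) (ζ^ₐ-cong ℓ (suc n) x≡y)

      orbit : ℤ → ℕ → ℤ
      orbit y i = T (Q ^ i * W + y)

      orbit-periodic : ∀ y → Periodic ρ (orbit y)
      orbit-periodic y = periodic-* period-k j
        where
        period-k : Periodic k (orbit y)
        period-k i = T-cong (+-congʳ-mod y (subst (λ x → x ≡ Q ^ i * W mod + N) Qᵏ⁺ⁱ (≡1-mod-*ˡ Qᵏ≡1 (Q ^ i * W))))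
          where Qᵏ⁺ⁱ : Q ^ k * (Q ^ i * W) ≡ Q ^ (k ℕ.+ i) * W
                Qᵏ⁺ⁱ = trans (sym (ℤ.*-assoc (Q ^ k) (Q ^ i) W)) (cong (_* W) (sym (ℤ.^-distribˡ-+-* Q k i)))

      orbit-translate : ∀ y i → orbit y (s ℕ.+ i) ≡ orbit (y + + d * U) i
      orbit-translate y i with ^-≡1-mod Q≡1 i
      ... | ≡-mod (divides t Qⁱ-1≡tℓ) = T-cong {Q ^ (s ℕ.+ i) * W + y} {Q ^ i * W + (y + + d * U)} (≡-mod (divides (t * U) (begin
        Q ^ (s ℕ.+ i) * W + y - (Q ^ i * W + (y + + d * U))
          ≡⟨ cong (λ x → x * W + y - (Q ^ i * W + (y + + d * U))) (ℤ.^-distribˡ-+-* Q s i) ⟩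
        Q ^ s * Q ^ i * W + y - (Q ^ i * W + (y + + d * U))
          ≡⟨ cong (λ D → Q ^ s * Q ^ i * W + y - (Q ^ i * W + (y + D))) W[Qˢ-1]≡dU ⟨
        Q ^ s * Q ^ i * W + y - (Q ^ i * W + (y + W * (Q ^ s - 1ℤ)))
          ≡⟨ factor (Q ^ s) (Q ^ i) W y ⟩
        (Q ^ i - 1ℤ) * (W * (Q ^ s - 1ℤ))
          ≡⟨ cong₂ _*_ Qⁱ-1≡tℓ W[Qˢ-1]≡dU ⟩
        t * + ℓ * (+ d * U)
          ≡⟨ regroup t (+ ℓ) (+ d) U ⟩
        t * U * (+ ℓ * + d)
          ≡⟨ cong (t * U *_) N≡ℓd ⟨
        t * U * + N ∎)))
        where
        open ≡-Reasoning
        factor : ∀ Qˢ P W y → Qˢ * P * W + y - (P * W + (y + W * (Qˢ - 1ℤ))) ≡ (P - 1ℤ) * (W * (Qˢ - 1ℤ))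
        factor = solve-∀
        regroup : ∀ t ℓ d U → t * ℓ * (d * U) ≡ t * U * (ℓ * d)
        regroup = solve-∀

      A : ℤ → ℤ
      A y = ∑[ i < ρ ] orbit y i

      A-cong : ∀ {x y} → x ≡ y mod (+ ℓ * + d) → A x ≡ A y
      A-cong x≡y = ∑-cong ρ λ i _ → T-cong (+-congˡ-mod (Q ^ i * W) (subst (λ m → _ ≡ _ mod m) (sym N≡ℓd) x≡y))

      A-translate : ∀ y → A (y + + d * U) ≡ A y
      A-translate y = trans (∑-cong ρ λ i _ → sym (orbit-translate y i)) (∑-periodic-shift ρ (orbit-periodic y) s)

      A-coset : ∀ c → A (+ c * + d) ≡ A 0ℤ
      A-coset c = trans (cong A (sym (ℤ.+-identityˡ (+ c * + d))))
                        (invariant-coset A-cong A-translate Uu≡1 (+ c) 0ℤ)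

      ℓ*A₀≡0 : + ℓ * A 0ℤ ≡ 0ℤ
      ℓ*A₀≡0 = begin
        + ℓ * A 0ℤ                                     ≡⟨ ∑-const ℓ (A 0ℤ) ⟨
        ∑[ c < ℓ ] A 0ℤ                                ≡⟨ ∑-cong ℓ (λ c _ → A-coset c) ⟨
        ∑[ c < ℓ ] ∑[ i < ρ ] orbit (+ c * + d) i      ≡⟨ ∑-comm ℓ ρ (λ c → orbit (+ c * + d)) ⟩
        ∑[ i < ρ ] ∑[ c < ℓ ] orbit (+ c * + d) i      ≡⟨ ∑-cong ρ (λ i _ → ∑-roots-of-unity (Q ^ i * W) e) ⟩
        ∑[ i < ρ ] 0ℤ                                  ≡⟨ ∑-zero ρ ⟩
        0ℤ                                             ∎
        where open ≡-Reasoning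

      ∑-orbit≡0 : ∑[ i < ρ ] ζ^ₐ (suc n) (Q ^ suc i * W) e ≡ 0ℤ
      ∑-orbit≡0 = begin
        ∑[ i < ρ ] T (Q ^ suc i * W)  ≡⟨ ∑-cong ρ (λ i _ → cong T (ℤ.+-identityʳ (Q ^ suc i * W))) ⟨
        ∑[ i < ρ ] orbit 0ℤ (suc i)   ≡⟨ ∑-periodic-suc ρ (orbit-periodic 0ℤ) ⟩
        A 0ℤ                          ≡⟨ ℤ.*-cancelˡ-≡ (+ ℓ) (A 0ℤ) 0ℤ (trans ℓ*A₀≡0 (sym (ℤ.*-zeroʳ (+ ℓ)))) ⟩
        0ℤ                            ∎
        where open ≡-Reasoning

  module _ (ℓ : ℕ) .{{_ : NonZero ℓ}} where
    open Cyclotomic ℓ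

    S-fixed : ∀ (q w : ℤ-adic ℓ) ρ n → + (ℓ ℕ.^ n) ∣ approx q n * approx w n - approx w n →
              ∀ e → S q w ρ n e ≡ + ρ * ζ^ₐ n (approx w n) e
    S-fixed q w ρ n W-fixed e = begin
      S q w ρ n e                         ≡⟨ Σ₁≡∑ ℓ n ρ _ e ⟩
      ∑[ i < ρ ] ζ^ₐ n (Q ^ suc i * W) e  ≡⟨ ∑-cong ρ (λ i _ → cong (λ v → v e) (ζ^ₐ-cong ℓ n (fixed-mod-^ {x = Q} {W} (≡-mod W-fixed) (suc i)))) ⟩
      ∑[ i < ρ ] ζ^ₐ n W e                ≡⟨ ∑-const ρ (ζ^ₐ n W e) ⟩
      + ρ * ζ^ₐ n W e                     ∎
      where
      open ≡-Reasoning
      Q = approx q n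
      W = approx w n


  ∑-orbit-vanishes : ∀ L n → Prime (suc L) → ¬ 2 ℕ.∣ suc L → ∀ {Q W} → Q ≡ 1ℤ mod + suc L →
                     ∀ k → Q ^ k ≡ 1ℤ mod + (suc L ℕ.^ suc n) → ¬ (+ (suc L ℕ.^ suc n) ∣ Q * W - W) →
                     ∀ j e → ∑[ i < j ℕ.* k ] Cyclotomic.ζ^ₐ (suc L) (suc n) (Q ^ suc i * W) e ≡ 0ℤ
  ∑-orbit-vanishes L n pr ℓ∤2 {Q} {W} Q≡1 k Qᵏ≡1 W-moves j e =
    let h , ℓ-odd                 = ∤2⇒odd (suc L) ℓ∤2
        s , U , W[Qˢ-1]≡dU , ℓ∤U  = lte-exact-level h W n ℓ-odd Q≡1 W-moves
        u , Uu≡1                  = inverse-mod-prime U pr ℓ∤U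
    in  Vanishing.∑-orbit≡0 L n Q W Q≡1 k Qᵏ≡1 s U u W[Qˢ-1]≡dU Uu≡1 j e

  S-moving : ∀ ℓ .{{_ : NonZero ℓ}} → Prime ℓ → ¬ 2 ℕ.∣ ℓ → (q w : ℤ-adic ℓ) →
             + (ℓ ℕ.^ 1) Unsigned.∣ approx q 1 - 1ℤ → ∀ n k → + (ℓ ℕ.^ n) Unsigned.∣ approx q n ^ k - 1ℤ →
             ¬ (+ (ℓ ℕ.^ n) ∣ approx q n * approx w n - approx w n) →
             ∀ j e → Cyclotomic.S ℓ q w (j ℕ.* k) n e ≡ 0ℤ
  S-moving zero pr = ⊥-elim (¬prime[0] pr)
  S-moving (suc L) pr ℓ∤2 q w q₁≡1 zero k _ W-moves j e =
    ⊥-elim (W-moves (divides (approx q 0 * approx w 0 - approx w 0) (sym (ℤ.*-identityʳ _))))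
  S-moving (suc L) pr ℓ∤2 q w q₁≡1 (suc n) k Qᵏ≡1 W-moves j e =
    trans (Σ₁≡∑ (suc L) (suc n) (j ℕ.* k) _ e)
          (∑-orbit-vanishes L n pr ℓ∤2 {approx q (suc n)} {approx w (suc n)}
                            (approx-≡1 (suc L) q q₁≡1 n) k (∣ᵤ⇒≡-mod Qᵏ≡1) W-moves j e)

open import Defs
open import Data.Nat using (ℕ; NonZero; _<_; _^_)
open import Data.Nat.Primality using (Prime)
open import Data.Nat.Divisibility using () renaming (_∣_ to _∣ℕ_)
open import Data.Integer using (+_; 1ℤ; _-_)
open import Data.Integer.Divisibility using (_∣_)
open import Relation.Nullary using (¬_)

import Data.Nat as ℕ
import Data.Nat.Divisibility as ℕ
import Data.Integer as ℤ
import Data.Integer.Properties as ℤ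
import Data.Integer.Divisibility.Signed as Signed
open import Data.Product using (_,_)
open import Relation.Nullary using (yes; no)
open import Relation.Binary.PropositionalEquality using (refl; trans; sym)
open AdicApproximation using (divisible-exact)
open OrbitSum using (S-fixed; S-moving)

lemma3p11 : (ℓ : ℕ) → .{{_ : NonZero ℓ}} → Prime ℓ → ¬ (2 ∣ℕ ℓ) →
    (q : ℤ-adic ℓ) → (+ (ℓ ^ 1)) ∣ (approx q 1 - 1ℤ) → ¬ (q ≈ₐ oneₐ ℓ) →
    (n k : ℕ) → IsLeastOrder q n k →
    (ρ : ℕ) → 0 < ρ → k ∣ℕ ρ →
    (w : ℤ-adic ℓ) →
    Cyclotomic.DivisibleInℤₗζ ℓ n ρ (Cyclotomic.S ℓ q w ρ n)
lemma3p11 ℓ ℓ-prime ℓ∤2 q q₁≡1 _ n k (_ , qᵏ≡1 , _) _ _ (ℕ.divides j refl) w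
  with + (ℓ ^ n) Signed.∣? approx q n ℤ.* approx w n - approx w n
... | yes w-fixed = divisible-exact ℓ n (j ℕ.* k) (Cyclotomic.ζ^ₐ ℓ n (approx w n))
                      (S-fixed ℓ q w (j ℕ.* k) n w-fixed)
... | no  w-moves = divisible-exact ℓ n (j ℕ.* k) (λ _ → ℤ.0ℤ) λ e →
        trans (S-moving ℓ ℓ-prime ℓ∤2 q w q₁≡1 n k qᵏ≡1 w-moves j e) (sym (ℤ.*-zeroʳ (+ (j ℕ.* k))))
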